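{- For every species $S$ of the bond-calculus there is a unique (up to structural congruence $\equiv$ of its elements) finite multiset of prime species $\operatorname{primes}(S) = \{\!\{P_1,\ldots,P_n\}\!\}$ such that \[ S \equiv P_1 \mid \cdots \mid P_n . \] (For $n=0$ the empty parallel composition is the null species $0$.)
   Context: Bond-calculus species are terms built from: the null species $0$; prefixes $s@\ell(m_1,\ldots,m_k).A$ (a reaction site $s$ at location $\ell$, which upon reaction binds the location names $m_1,\ldots,m_k$ in the continuation species $A$; the location may be omitted); choice $A + B$; parallel composition $A \mid B$; location restriction $(\nu\,\ell_1,\ldots,\ell_n)A$ (binding the location names $\ell_i$ in $A$); and named species $X_{\ell_1,\ldots,\ell_n}$ given by definitions $X_{\ell_1,\ldots,\ell_n} \triangleq A$, where every recursive occurrence of a defined name in a body lies under a prefix. Structural congruence $\equiv$ is the smallest congruence on species, as in the $\pi$-calculus, such that: terms equal up to $\alpha$-renaming of bound location names are congruent; $\mid$ is associative and commutative with unit $0$; $+$ is associative and commutative; $(\nu\,\ell)0 \equiv 0$; $(\nu\,\ell)(\nu\,m)A \equiv (\nu\,m)(\nu\,\ell)A$; $(\nu\,\ell)(A \mid B) \equiv A \mid (\nu\,\ell)B$ whenever $\ell$ is not free in $A$; and a named species is congruent to the (suitably instantiated) body of its definition. A species $S$ is prime if for all species $A, B$, $S \equiv A \mid B$ implies $A \equiv 0$ or $B \equiv 0$. -}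

module Defs where

open import Data.Nat using (ℕ; zero; suc; _+_)
open import Data.Fin using (Fin; zero; suc; _↑ˡ_; _↑ʳ_; splitAt)
open import Data.Maybe using (Maybe)
import Data.Maybe as Maybe
open import Data.Vec using (Vec; lookup)
import Data.Vec as Vec
open import Data.Sum using (_⊎_; [_,_])
open import Data.Product using (Σ; _×_; _,_)
open import Relation.Nullary using (¬_)
open import Data.List using (List; []; _∷_)
open import Data.List.Relation.Unary.All using (All)
open import Relation.Binary.Bundles using (Setoid)
open import Relation.Binary.Structures using (IsEquivalence)
open import Relation.Binary.Construct.Closure.ReflexiveTransitive using (Star)
import Data.List.Relation.Binary.Permutation.Setoid as PermS

-- There are d defined names X : Fin d (a finite set of definitions),
--   X taking  ar X  location parameters.
--   Sp n : species whose free location names are among Fin n.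
-- Bound location names are de Bruijn indices, so alpha-equivalent terms
-- are syntactically equal.

module _ (Site : Set) {d : ℕ} (ar : Fin d → ℕ) where

  infixr 6 _∥_
  infixr 7 _⊕_

  data Sp (n : ℕ) : Set where
    𝟎    : Sp n
    -- s@ℓ(m₁,…,m_k).A : site s, optional location ℓ, binds k names in A
    -- (the bound names are the first k indices of Fin (k + n))
    pre  : Site → Maybe (Fin n) → (k : ℕ) → Sp (k + n) → Sp n
    _⊕_  : Sp n → Sp n → Sp n
    _∥_  : Sp n → Sp n → Sp n
    -- restriction (ν ℓ) A of one name (n-ary restriction = nested ν)
    ν    : Sp (suc n) → Sp n
    call : (X : Fin d) → Vec (Fin n) (ar X) → Sp n

  liftR : ∀ {n m} k → (Fin n → Fin m) → Fin (k + n) → Fin (k + m)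
  liftR {n} {m} k ρ i = [ (λ j → j ↑ˡ m) , (λ j → k ↑ʳ ρ j) ] (splitAt k i)

  ren : ∀ {n m} → (Fin n → Fin m) → Sp n → Sp m
  ren ρ 𝟎 = 𝟎
  ren ρ (pre s l k A) = pre s (Maybe.map ρ l) k (ren (liftR k ρ) A)
  ren ρ (A ⊕ B) = ren ρ A ⊕ ren ρ B
  ren ρ (A ∥ B) = ren ρ A ∥ ren ρ B
  ren ρ (ν A) = ν (ren (liftR 1 ρ) A)
  ren ρ (call X v) = call X (Vec.map ρ v)

  swap01 : ∀ {n} → Fin (suc (suc n)) → Fin (suc (suc n))
  swap01 zero = suc zero
  swap01 (suc zero) = zero
  swap01 (suc (suc i)) = suc (suc i)

  par : ∀ {n} → List (Sp n) → Sp n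
  par [] = 𝟎
  par (P ∷ Ps) = P ∥ par Ps

  data Occ (Y : Fin d) : ∀ {n} → Sp n → Set where
    pre  : ∀ {n s l k} {A : Sp (k + n)} → Occ Y A → Occ Y (pre s l k A)
    ⊕ˡ   : ∀ {n} {A B : Sp n} → Occ Y A → Occ Y (A ⊕ B)
    ⊕ʳ   : ∀ {n} {A B : Sp n} → Occ Y B → Occ Y (A ⊕ B)
    ∥ˡ   : ∀ {n} {A B : Sp n} → Occ Y A → Occ Y (A ∥ B)
    ∥ʳ   : ∀ {n} {A B : Sp n} → Occ Y B → Occ Y (A ∥ B)
    ν    : ∀ {n} {A : Sp (suc n)} → Occ Y A → Occ Y (ν A)
    here : ∀ {n} {v : Vec (Fin n) (ar Y)} → Occ Y (call Y v)

  data UOcc (Y : Fin d) : ∀ {n} → Sp n → Set where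
    ⊕ˡ   : ∀ {n} {A B : Sp n} → UOcc Y A → UOcc Y (A ⊕ B)
    ⊕ʳ   : ∀ {n} {A B : Sp n} → UOcc Y B → UOcc Y (A ⊕ B)
    ∥ˡ   : ∀ {n} {A B : Sp n} → UOcc Y A → UOcc Y (A ∥ B)
    ∥ʳ   : ∀ {n} {A B : Sp n} → UOcc Y B → UOcc Y (A ∥ B)
    ν    : ∀ {n} {A : Sp (suc n)} → UOcc Y A → UOcc Y (ν A)
    here : ∀ {n} {v : Vec (Fin n) (ar Y)} → UOcc Y (call Y v)

  -- A system of definitions  X_{ℓ₁,…,ℓ_{ar X}} ≜ body X
  module _ (body : (X : Fin d) → Sp (ar X)) where

    Mentions : Fin d → Fin d → Set
    Mentions Y Z = Occ Z (body Y)

    -- Every recursive occurrence lies under a prefix: an occurrence of Y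
    -- in the body of X is recursive if Y = X or the definition of Y
    -- (transitively) mentions X; such occurrences must be guarded.
    Guarded : Set
    Guarded = ∀ X Y → UOcc Y (body X) → ¬ Star Mentions Y X

    infix 4 _≅_

    data _≅_ : ∀ {n} → Sp n → Sp n → Set where
      ≅-refl  : ∀ {n} {A : Sp n} → A ≅ A
      ≅-sym   : ∀ {n} {A B : Sp n} → A ≅ B → B ≅ A
      ≅-trans : ∀ {n} {A B C : Sp n} → A ≅ B → B ≅ C → A ≅ C
      pre-cong : ∀ {n s l k} {A B : Sp (k + n)} → A ≅ B → pre s l k A ≅ pre s l k B
      ⊕-cong  : ∀ {n} {A A′ B B′ : Sp n} → A ≅ A′ → B ≅ B′ → A ⊕ B ≅ A′ ⊕ B′
      ∥-cong  : ∀ {n} {A A′ B B′ : Sp n} → A ≅ A′ → B ≅ B′ → A ∥ B ≅ A′ ∥ B′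
      ν-cong  : ∀ {n} {A B : Sp (suc n)} → A ≅ B → ν A ≅ ν B
      ∥-assoc : ∀ {n} {A B C : Sp n} → (A ∥ B) ∥ C ≅ A ∥ (B ∥ C)
      ∥-comm  : ∀ {n} {A B : Sp n} → A ∥ B ≅ B ∥ A
      ∥-unit  : ∀ {n} {A : Sp n} → A ∥ 𝟎 ≅ A
      ⊕-assoc : ∀ {n} {A B C : Sp n} → (A ⊕ B) ⊕ C ≅ A ⊕ (B ⊕ C)
      ⊕-comm  : ∀ {n} {A B : Sp n} → A ⊕ B ≅ B ⊕ A
      ν-zero  : ∀ {n} → ν {n} 𝟎 ≅ 𝟎
      ν-swap  : ∀ {n} {A : Sp (suc (suc n))} → ν (ν A) ≅ ν (ν (ren swap01 A))
      ν-extr  : ∀ {n} {A : Sp n} {B : Sp (suc n)} → ν (ren suc A ∥ B) ≅ A ∥ ν B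
      unfold  : ∀ {n} {X : Fin d} {v : Vec (Fin n) (ar X)} → call X v ≅ ren (lookup v) (body X)

    ≅-setoid : ℕ → Setoid _ _
    ≅-setoid n = record
      { Carrier = Sp n
      ; _≈_ = _≅_
      ; isEquivalence = record { refl = ≅-refl ; sym = ≅-sym ; trans = ≅-trans } }

    Prime : ∀ {n} → Sp n → Set
    Prime {n} S = ¬ (S ≅ 𝟎) × (∀ (A B : Sp n) → S ≅ A ∥ B → A ≅ 𝟎 ⊎ B ≅ 𝟎)

    -- finite multisets of species up to ≅ of their elements
    _≈ₘ_ : ∀ {n} → List (Sp n) → List (Sp n) → Set
    _≈ₘ_ {n} = PermS._↭_ (≅-setoid n)

    PrimeDecomp : ∀ {n} → Sp n → List (Sp n) → Set
    PrimeDecomp S Ps = All Prime Ps × S ≅ par Ps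

module Submission where

-- Every species has a normal form: the list of its components, obtained by unfolding unguarded calls
-- (which terminates because recursion is guarded), flattening parallel composition, and resolving each
-- restriction by extruding the components that do not use its name while keeping those that do together
-- under one ν. Deciding whether a component uses a name needs the free names of the recursive
-- definitions; they are the greatest fixed point of a monotone operator on the finitely many parameters,
-- and with them free names become invariant under ≡. Every axiom of ≡ changes the normal form only by a
-- permutation and by ≡ on components (the exchange of two restrictions is the one delicate case). Each
-- component has a one-element normal form, hence is prime, and conversely every prime has a one-element
-- normal form, so any prime decomposition of S is the normal form of S up to permutation and ≡.

open import Defs
open import Algebra.Structures using (IsCommutativeMonoid)
open import Data.Bool using (Bool; true; false; T)
open import Data.Bool.Properties using () renaming (_≟_ to _≟ᴮ_)
open import Data.Empty using (⊥-elim)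
open import Data.Fin using (Fin; zero; suc; _↑ˡ_; _↑ʳ_; splitAt)
open import Data.Fin.Induction using (spo-wellFounded)
open import Data.Fin.Properties using (splitAt-↑ˡ; splitAt-↑ʳ; splitAt⁻¹-↑ʳ; ↑ʳ-injective; suc-injective; any?; all?; ¬∀⟶∃¬)
  renaming (_≟_ to _≟ᶠ_)
open import Data.List using (List; []; _∷_; _++_; map; filter; foldr; length)
open import Data.List.Properties using (map-++; map-∘; ++-assoc; ++-identityʳ; filter-all; filter-none; filter-++; partition-defn)
open import Data.List.Relation.Unary.All using (All; []; _∷_)
import Data.List.Relation.Unary.All as All
open import Data.List.Relation.Unary.All.Properties using (all-filter; filter⁺) renaming (map⁺ to All-map⁺; ++⁺ to All-++⁺)
open import Data.List.Relation.Unary.Any using (Any; here; there)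
open import Data.List.Relation.Unary.Any.Properties using () renaming (++⁺ʳ to Any-++⁺ʳ)
import Data.List.Relation.Binary.Permutation.Setoid as PermutationSetoid
import Data.List.Relation.Binary.Permutation.Setoid.Properties as PermutationSetoidProperties
open import Data.Maybe using (just; nothing)
import Data.Maybe as Maybe
import Data.Maybe.Properties as Maybe
open import Data.Nat using (ℕ; zero; suc; _+_; _≤_; _<_; z≤n; s≤s; s≤s⁻¹)
open import Data.Nat.Properties using (≤-refl; +-mono-≤; +-mono-<-≤; +-mono-≤-<; <-≤-trans; n≮0)
open import Data.Product using (Σ; _×_; _,_; proj₁; proj₂)
open import Data.Sum using (_⊎_; inj₁; inj₂; [_,_])
open import Data.Unit using (tt)
open import Data.Vec using (Vec; lookup; []; _∷_)
import Data.Vec as Vec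
import Data.Vec.Properties as Vec
open import Function using (_∘_; _⇔_; mk⇔; Equivalence)
import Function.Properties.Equivalence as ⇔
open import Induction.WellFounded using (Acc; acc; WellFounded)
open import Relation.Binary.Bundles using (Setoid)
open import Relation.Binary.Construct.Closure.ReflexiveTransitive using (Star; ε; _◅_; _◅◅_)
open import Relation.Binary.Construct.Closure.Transitive as Plus using (TransClosure; wellFounded⁻)
open import Relation.Binary.PropositionalEquality hiding ([_])
open import Relation.Nullary using (Dec; yes; no; ¬_)
open import Relation.Nullary.Decidable using (_×-dec_; T?; isYes; toWitness; fromWitness)
open import Relation.Unary using (∁)
open import Relation.Unary.Properties using (∁?)

module _ (Site : Set) {d : ℕ} (ar : Fin d → ℕ) (body : (X : Fin d) → Sp Site ar (ar X)) where

  Species : ℕ → Set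
  Species = Sp Site ar

  ren′ : ∀ {n m} → (Fin n → Fin m) → Species n → Species m
  ren′ = ren Site ar

  lift : ∀ {n m} k → (Fin n → Fin m) → Fin (k + n) → Fin (k + m)
  lift = liftR Site ar

  par′ : ∀ {n} → List (Species n) → Species n
  par′ = par Site ar

  swap : ∀ {n} → Fin (suc (suc n)) → Fin (suc (suc n))
  swap = swap01 Site ar

  infix 4 _≃_
  _≃_ : ∀ {n} → Species n → Species n → Set
  _≃_ = _≅_ Site ar body

  ≡⇒≃ : ∀ {n} {A B : Species n} → A ≡ B → A ≃ B
  ≡⇒≃ refl = ≅-refl

  lift-cong : ∀ {n m} k {f g : Fin n → Fin m} → (∀ i → f i ≡ g i) → ∀ i → lift k f i ≡ lift k g i
  lift-cong k f≗g i with splitAt k i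
  ... | inj₁ j = refl
  ... | inj₂ j = cong (k ↑ʳ_) (f≗g j)

  ren-cong : ∀ {n m} {f g : Fin n → Fin m} → (∀ i → f i ≡ g i) → (A : Species n) → ren′ f A ≡ ren′ g A
  ren-cong f≗g 𝟎 = refl
  ren-cong f≗g (pre s l k A) = cong₂ (λ l′ A′ → pre s l′ k A′) (Maybe.map-cong f≗g l) (ren-cong (lift-cong k f≗g) A)
  ren-cong f≗g (A ⊕ B) = cong₂ _⊕_ (ren-cong f≗g A) (ren-cong f≗g B)
  ren-cong f≗g (A ∥ B) = cong₂ _∥_ (ren-cong f≗g A) (ren-cong f≗g B)
  ren-cong f≗g (ν A) = cong ν (ren-cong (lift-cong 1 f≗g) A)
  ren-cong f≗g (call X v) = cong (call X) (Vec.map-cong f≗g v)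

  lift-∘ : ∀ {n m p} k (f : Fin m → Fin p) (g : Fin n → Fin m) → ∀ i → lift k (f ∘ g) i ≡ lift k f (lift k g i)
  lift-∘ {m = m} {p} k f g i with splitAt k i
  ... | inj₁ j = cong [ (_↑ˡ p) , (λ j → k ↑ʳ f j) ] (sym (splitAt-↑ˡ k j m))
  ... | inj₂ j = cong [ (_↑ˡ p) , (λ j → k ↑ʳ f j) ] (sym (splitAt-↑ʳ k m (g j)))

  lift-↑ʳ : ∀ {n m} k (ρ : Fin n → Fin m) i → lift k ρ (k ↑ʳ i) ≡ k ↑ʳ ρ i
  lift-↑ʳ {m = m} k ρ i = cong [ (_↑ˡ m) , (λ j → k ↑ʳ ρ j) ] (splitAt-↑ʳ k _ i)

  ren-∘ : ∀ {n m p} (f : Fin m → Fin p) (g : Fin n → Fin m) (A : Species n) → ren′ f (ren′ g A) ≡ ren′ (f ∘ g) A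
  ren-∘ f g 𝟎 = refl
  ren-∘ f g (pre s l k A) = cong₂ (λ l′ A′ → pre s l′ k A′) (sym (Maybe.map-∘ l))
    (trans (ren-∘ (lift k f) (lift k g) A) (sym (ren-cong (lift-∘ k f g) A)))
  ren-∘ f g (A ⊕ B) = cong₂ _⊕_ (ren-∘ f g A) (ren-∘ f g B)
  ren-∘ f g (A ∥ B) = cong₂ _∥_ (ren-∘ f g A) (ren-∘ f g B)
  ren-∘ f g (ν A) = cong ν (trans (ren-∘ (lift 1 f) (lift 1 g) A) (sym (ren-cong (lift-∘ 1 f g) A)))
  ren-∘ f g (call X v) = cong (call X) (sym (Vec.map-∘ f g v))

  ren-par : ∀ {n m} (f : Fin n → Fin m) (As : List (Species n)) → ren′ f (par′ As) ≡ par′ (map (ren′ f) As)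
  ren-par f [] = refl
  ren-par f (A ∷ As) = cong (ren′ f A ∥_) (ren-par f As)

  ren-unfold : ∀ {n m} (f : Fin n → Fin m) X (v : Vec (Fin n) (ar X))
             → ren′ (lookup (Vec.map f v)) (body X) ≡ ren′ f (ren′ (lookup v) (body X))
  ren-unfold f X v = trans (ren-cong (λ p → Vec.lookup-map p f v) (body X)) (sym (ren-∘ f (lookup v) (body X)))

  swap-lift₂ : ∀ {n m} (f : Fin n → Fin m) i → swap (lift 1 (lift 1 f) i) ≡ lift 1 (lift 1 f) (swap i)
  swap-lift₂ f zero = refl
  swap-lift₂ f (suc zero) = refl
  swap-lift₂ f (suc (suc i)) = refl

  ren-≃ : ∀ {n m} (f : Fin n → Fin m) {A B : Species n} → A ≃ B → ren′ f A ≃ ren′ f B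
  ren-≃ f ≅-refl = ≅-refl
  ren-≃ f (≅-sym A≃B) = ≅-sym (ren-≃ f A≃B)
  ren-≃ f (≅-trans A≃B B≃C) = ≅-trans (ren-≃ f A≃B) (ren-≃ f B≃C)
  ren-≃ f (pre-cong {k = k} A≃B) = pre-cong (ren-≃ (lift k f) A≃B)
  ren-≃ f (⊕-cong A≃A′ B≃B′) = ⊕-cong (ren-≃ f A≃A′) (ren-≃ f B≃B′)
  ren-≃ f (∥-cong A≃A′ B≃B′) = ∥-cong (ren-≃ f A≃A′) (ren-≃ f B≃B′)
  ren-≃ f (ν-cong A≃B) = ν-cong (ren-≃ (lift 1 f) A≃B)
  ren-≃ f ∥-assoc = ∥-assoc
  ren-≃ f ∥-comm = ∥-comm
  ren-≃ f ∥-unit = ∥-unit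
  ren-≃ f ⊕-assoc = ⊕-assoc
  ren-≃ f ⊕-comm = ⊕-comm
  ren-≃ f ν-zero = ν-zero
  ren-≃ f (ν-swap {A = A}) = subst (λ B → ν (ν (ren′ f₂ A)) ≃ ν (ν B)) swap-commutes ν-swap
    where
      f₂ = lift 1 (lift 1 f)
      swap-commutes : ren′ swap (ren′ f₂ A) ≡ ren′ f₂ (ren′ swap A)
      swap-commutes = trans (ren-∘ swap f₂ A) (trans (ren-cong (swap-lift₂ f) A) (sym (ren-∘ f₂ swap A)))
  ren-≃ f (ν-extr {A = A} {B = B}) =
    subst (λ A′ → ν (A′ ∥ ren′ (lift 1 f) B) ≃ ren′ f A ∥ ν (ren′ (lift 1 f) B)) shift-commutes ν-extr
    where
      shift-commutes : ren′ suc (ren′ f A) ≡ ren′ (lift 1 f) (ren′ suc A)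
      shift-commutes = trans (ren-∘ suc f A) (sym (ren-∘ (lift 1 f) suc A))
  ren-≃ f (unfold {X = X} {v = v}) = subst (call X (Vec.map f v) ≃_) (ren-unfold f X v) unfold

  lift-preimage : ∀ {n m} k (ρ : Fin n → Fin m) i j → lift k ρ i ≡ k ↑ʳ j
                → Σ (Fin n) λ b → i ≡ k ↑ʳ b × ρ b ≡ j
  lift-preimage {m = m} k ρ i j eq with splitAt k i in split≡
  ... | inj₁ a with () ← trans (sym (splitAt-↑ˡ k a m)) (trans (cong (splitAt k) eq) (splitAt-↑ʳ k m j))
  ... | inj₂ b = b , sym (splitAt⁻¹-↑ʳ split≡) , ↑ʳ-injective k (ρ b) j eq

  ParamSet : Set
  ParamSet = (X : Fin d) → Fin (ar X) → Bool

  _⊆ₚ_ : ParamSet → ParamSet → Set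
  N ⊆ₚ N′ = ∀ X p → T (N X p) → T (N′ X p)

  data Free (N : ParamSet) : ∀ {n} → Fin n → Species n → Set where
    site  : ∀ {n s k i} {A : Species (k + n)} → Free N i (pre s (just i) k A)
    under : ∀ {n s l k i} {A : Species (k + n)} → Free N (k ↑ʳ i) A → Free N i (pre s l k A)
    ⊕ˡ    : ∀ {n i} {A B : Species n} → Free N i A → Free N i (A ⊕ B)
    ⊕ʳ    : ∀ {n i} {A B : Species n} → Free N i B → Free N i (A ⊕ B)
    ∥ˡ    : ∀ {n i} {A B : Species n} → Free N i A → Free N i (A ∥ B)
    ∥ʳ    : ∀ {n i} {A B : Species n} → Free N i B → Free N i (A ∥ B)
    ν     : ∀ {n i} {A : Species (suc n)} → Free N (suc i) A → Free N i (ν A)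
    call  : ∀ {n i X p} {v : Vec (Fin n) (ar X)} → T (N X p) → lookup v p ≡ i → Free N i (call X v)

  free? : (N : ParamSet) → ∀ {n} (i : Fin n) (A : Species n) → Dec (Free N i A)
  free? N i 𝟎 = no λ ()
  free? N i (pre s l k A) with free? N (k ↑ʳ i) A | l
  ... | yes i∈A | _ = yes (under i∈A)
  ... | no i∉A | nothing = no λ { (under i∈A) → i∉A i∈A }
  ... | no i∉A | just j with j ≟ᶠ i
  ...   | yes refl = yes site
  ...   | no j≢i = no λ { site → j≢i refl ; (under i∈A) → i∉A i∈A }
  free? N i (A ⊕ B) with free? N i A | free? N i B
  ... | yes i∈A | _ = yes (⊕ˡ i∈A)
  ... | no _ | yes i∈B = yes (⊕ʳ i∈B)
  ... | no i∉A | no i∉B = no λ { (⊕ˡ i∈A) → i∉A i∈A ; (⊕ʳ i∈B) → i∉B i∈B }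
  free? N i (A ∥ B) with free? N i A | free? N i B
  ... | yes i∈A | _ = yes (∥ˡ i∈A)
  ... | no _ | yes i∈B = yes (∥ʳ i∈B)
  ... | no i∉A | no i∉B = no λ { (∥ˡ i∈A) → i∉A i∈A ; (∥ʳ i∈B) → i∉B i∈B }
  free? N i (ν A) with free? N (suc i) A
  ... | yes i∈A = yes (ν i∈A)
  ... | no i∉A = no λ { (ν i∈A) → i∉A i∈A }
  free? N i (call X v) with any? (λ p → T? (N X p) ×-dec (lookup v p ≟ᶠ i))
  ... | yes (p , p∈N , v[p]≡i) = yes (call p∈N v[p]≡i)
  ... | no ∄p = no λ { (call {p = p} p∈N v[p]≡i) → ∄p (p , p∈N , v[p]≡i) }

  free-ren⁺ : ∀ {N n m} (ρ : Fin n → Fin m) {i} {A : Species n} → Free N i A → Free N (ρ i) (ren′ ρ A)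
  free-ren⁺ ρ site = site
  free-ren⁺ ρ (under {k = k} {i = i} i∈A) = under (subst (λ j → Free _ j _) (lift-↑ʳ k ρ i) (free-ren⁺ (lift k ρ) i∈A))
  free-ren⁺ ρ (⊕ˡ i∈A) = ⊕ˡ (free-ren⁺ ρ i∈A)
  free-ren⁺ ρ (⊕ʳ i∈B) = ⊕ʳ (free-ren⁺ ρ i∈B)
  free-ren⁺ ρ (∥ˡ i∈A) = ∥ˡ (free-ren⁺ ρ i∈A)
  free-ren⁺ ρ (∥ʳ i∈B) = ∥ʳ (free-ren⁺ ρ i∈B)
  free-ren⁺ ρ (ν i∈A) = ν (free-ren⁺ (lift 1 ρ) i∈A)
  free-ren⁺ ρ (call {p = p} {v = v} p∈N refl) = call p∈N (Vec.lookup-map p ρ v)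

  free-ren⁻ : ∀ {N n m} (ρ : Fin n → Fin m) {j} (A : Species n) → Free N j (ren′ ρ A)
            → Σ (Fin n) λ i → ρ i ≡ j × Free N i A
  free-ren⁻ ρ (pre s (just i) k A) site = i , refl , site
  free-ren⁻ ρ (pre s l k A) (under {i = j} j∈ρA) with free-ren⁻ (lift k ρ) A j∈ρA
  ... | i′ , ρi′≡j , i′∈A with lift-preimage k ρ i′ j ρi′≡j
  ...   | i , refl , ρi≡j = i , ρi≡j , under i′∈A
  free-ren⁻ ρ (A ⊕ B) (⊕ˡ j∈ρA) with free-ren⁻ ρ A j∈ρA
  ... | i , ρi≡j , i∈A = i , ρi≡j , ⊕ˡ i∈A
  free-ren⁻ ρ (A ⊕ B) (⊕ʳ j∈ρB) with free-ren⁻ ρ B j∈ρB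
  ... | i , ρi≡j , i∈B = i , ρi≡j , ⊕ʳ i∈B
  free-ren⁻ ρ (A ∥ B) (∥ˡ j∈ρA) with free-ren⁻ ρ A j∈ρA
  ... | i , ρi≡j , i∈A = i , ρi≡j , ∥ˡ i∈A
  free-ren⁻ ρ (A ∥ B) (∥ʳ j∈ρB) with free-ren⁻ ρ B j∈ρB
  ... | i , ρi≡j , i∈B = i , ρi≡j , ∥ʳ i∈B
  free-ren⁻ ρ (ν A) (ν j∈ρA) with free-ren⁻ (lift 1 ρ) A j∈ρA
  ... | suc i , ρi≡j , i∈A = i , suc-injective ρi≡j , ν i∈A
  free-ren⁻ ρ (call X v) (call {p = p} p∈N v[p]≡j) =
    lookup v p , trans (sym (Vec.lookup-map p ρ v)) v[p]≡j , call p∈N refl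

  free-mono : ∀ {N N′} → N ⊆ₚ N′ → ∀ {n i} {A : Species n} → Free N i A → Free N′ i A
  free-mono N⊆N′ site = site
  free-mono N⊆N′ (under i∈A) = under (free-mono N⊆N′ i∈A)
  free-mono N⊆N′ (⊕ˡ i∈A) = ⊕ˡ (free-mono N⊆N′ i∈A)
  free-mono N⊆N′ (⊕ʳ i∈B) = ⊕ʳ (free-mono N⊆N′ i∈B)
  free-mono N⊆N′ (∥ˡ i∈A) = ∥ˡ (free-mono N⊆N′ i∈A)
  free-mono N⊆N′ (∥ʳ i∈B) = ∥ʳ (free-mono N⊆N′ i∈B)
  free-mono N⊆N′ (ν i∈A) = ν (free-mono N⊆N′ i∈A)
  free-mono N⊆N′ (call p∈N v[p]≡i) = call (N⊆N′ _ _ p∈N) v[p]≡i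

  step : ParamSet → ParamSet
  step N X p = isYes (free? N p (body X))

  step-mono : ∀ {N N′} → N ⊆ₚ N′ → step N ⊆ₚ step N′
  step-mono N⊆N′ X p p∈stepN = fromWitness (free-mono N⊆N′ (toWitness p∈stepN))

  approx : ℕ → ParamSet
  approx zero X p = true
  approx (suc k) = step (approx k)

  approx-suc⊆ : ∀ k → approx (suc k) ⊆ₚ approx k
  approx-suc⊆ zero X p _ = tt
  approx-suc⊆ (suc k) = step-mono (approx-suc⊆ k)

  sumFin : ∀ n → (Fin n → ℕ) → ℕ
  sumFin zero f = 0
  sumFin (suc n) f = f zero + sumFin n (f ∘ suc)

  sumFin-mono : ∀ n {f g : Fin n → ℕ} → (∀ i → f i ≤ g i) → sumFin n f ≤ sumFin n g
  sumFin-mono zero f≤g = z≤n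
  sumFin-mono (suc n) f≤g = +-mono-≤ (f≤g zero) (sumFin-mono n (f≤g ∘ suc))

  sumFin-strict : ∀ n {f g : Fin n → ℕ} → (∀ i → f i ≤ g i) → ∀ j → f j < g j → sumFin n f < sumFin n g
  sumFin-strict (suc n) f≤g zero fj<gj = +-mono-<-≤ fj<gj (sumFin-mono n (f≤g ∘ suc))
  sumFin-strict (suc n) f≤g (suc j) fj<gj = +-mono-≤-< (f≤g zero) (sumFin-strict n (f≤g ∘ suc) j fj<gj)

  count : Bool → ℕ
  count true = 1
  count false = 0

  count-mono : ∀ {a b} → (T a → T b) → count a ≤ count b
  count-mono {false} _ = z≤n
  count-mono {true} {true} _ = s≤s z≤n
  count-mono {true} {false} a⇒b = ⊥-elim (a⇒b tt)

  count-strict : ∀ {a b} → (T a → T b) → a ≢ b → count a < count b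
  count-strict {false} {false} _ a≢b = ⊥-elim (a≢b refl)
  count-strict {false} {true} _ _ = s≤s z≤n
  count-strict {true} {true} _ a≢b = ⊥-elim (a≢b refl)
  count-strict {true} {false} a⇒b _ = ⊥-elim (a⇒b tt)

  size : ParamSet → ℕ
  size N = sumFin d λ X → sumFin (ar X) λ p → count (N X p)

  size-strict : ∀ {N N′} → N ⊆ₚ N′ → ∀ X p → N X p ≢ N′ X p → size N < size N′
  size-strict N⊆N′ X p ≢ = sumFin-strict d (λ X → sumFin-mono (ar X) λ p → count-mono (N⊆N′ X p)) X
    (sumFin-strict (ar X) (λ p → count-mono (N⊆N′ X p)) p (count-strict (N⊆N′ X p) ≢))

  IsFixed : ℕ → Set
  IsFixed k = ∀ X p → approx (suc k) X p ≡ approx k X p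

  fixedAt? : ∀ k X → Dec (∀ p → approx (suc k) X p ≡ approx k X p)
  fixedAt? k X = all? λ p → approx (suc k) X p ≟ᴮ approx k X p

  approx-stabilises : ∀ k b → size (approx k) ≤ b → Σ ℕ IsFixed
  approx-stabilises k b size≤b with all? (fixedAt? k)
  ... | yes fixed = k , fixed
  ... | no ¬fixed with ¬∀⟶∃¬ d _ (fixedAt? k) ¬fixed
  ...   | X , ¬fixedX with ¬∀⟶∃¬ (ar X) _ (λ p → approx (suc k) X p ≟ᴮ approx k X p) ¬fixedX
  ...     | p , ≢ with b | <-≤-trans (size-strict (approx-suc⊆ k) X p ≢) size≤b
  ...       | zero | size<0 = ⊥-elim (n≮0 size<0)
  ...       | suc b | size<1+b = approx-stabilises (suc k) b (s≤s⁻¹ size<1+b)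

  fixedStage : Σ ℕ IsFixed
  fixedStage = approx-stabilises 0 (size (approx 0)) ≤-refl

  -- The greatest fixed point of step: the approximations start from the full set and only shrink.
  freeParams : ParamSet
  freeParams = approx (proj₁ fixedStage)

  infix 4 _∈fn_
  _∈fn_ : ∀ {n} → Fin n → Species n → Set
  _∈fn_ = Free freeParams

  param-free⇒free-in-body : ∀ X p → T (freeParams X p) → p ∈fn body X
  param-free⇒free-in-body X p p∈N = toWitness (subst T (sym (proj₂ fixedStage X p)) p∈N)

  free-in-body⇒param-free : ∀ X p → p ∈fn body X → T (freeParams X p)
  free-in-body⇒param-free X p p∈body = subst T (proj₂ fixedStage X p) (fromWitness p∈body)

  map-cong-lookup : ∀ {n m k} (f g : Fin n → Fin m) (v : Vec (Fin n) k)
                  → (∀ p → f (lookup v p) ≡ g (lookup v p)) → Vec.map f v ≡ Vec.map g v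
  map-cong-lookup f g [] _ = refl
  map-cong-lookup f g (x ∷ v) agree = cong₂ _∷_ (agree zero) (map-cong-lookup f g v (agree ∘ suc))

  -- Stated for every stage k: a call is unfolded into stage k - 1, and at stage zero every parameter counts as free.
  ren-cong-free≃ : ∀ k {n m} (A : Species n) (ρ ρ′ : Fin n → Fin m)
                 → (∀ i → Free (approx k) i A → ρ i ≡ ρ′ i) → ren′ ρ A ≃ ren′ ρ′ A
  ren-cong-free≃ k 𝟎 ρ ρ′ agree = ≅-refl
  ren-cong-free≃ k (pre s l k′ A) ρ ρ′ agree =
    ≅-trans (pre-cong (ren-cong-free≃ k A (lift k′ ρ) (lift k′ ρ′) agree-lifted))
            (≡⇒≃ (cong (λ l′ → pre s l′ k′ _) (agree-site l agree)))
    where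
      agree-lifted : ∀ j → Free (approx k) j A → lift k′ ρ j ≡ lift k′ ρ′ j
      agree-lifted j j∈A with splitAt k′ j in split≡
      ... | inj₁ _ = refl
      ... | inj₂ i = cong (k′ ↑ʳ_) (agree i (under (subst (λ j → Free _ j A) (sym (splitAt⁻¹-↑ʳ split≡)) j∈A)))
      agree-site : ∀ l → (∀ i → Free (approx k) i (pre s l k′ A) → ρ i ≡ ρ′ i) → Maybe.map ρ l ≡ Maybe.map ρ′ l
      agree-site nothing _ = refl
      agree-site (just i) agree = cong just (agree i site)
  ren-cong-free≃ k (A ⊕ B) ρ ρ′ agree =
    ⊕-cong (ren-cong-free≃ k A ρ ρ′ (λ i → agree i ∘ ⊕ˡ)) (ren-cong-free≃ k B ρ ρ′ (λ i → agree i ∘ ⊕ʳ))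
  ren-cong-free≃ k (A ∥ B) ρ ρ′ agree =
    ∥-cong (ren-cong-free≃ k A ρ ρ′ (λ i → agree i ∘ ∥ˡ)) (ren-cong-free≃ k B ρ ρ′ (λ i → agree i ∘ ∥ʳ))
  ren-cong-free≃ k (ν A) ρ ρ′ agree = ν-cong (ren-cong-free≃ k A (lift 1 ρ) (lift 1 ρ′) agree-lifted)
    where
      agree-lifted : ∀ j → Free (approx k) j A → lift 1 ρ j ≡ lift 1 ρ′ j
      agree-lifted zero _ = refl
      agree-lifted (suc i) i∈A = cong suc (agree i (ν i∈A))
  ren-cong-free≃ zero (call X v) ρ ρ′ agree =
    ≡⇒≃ (cong (call X) (map-cong-lookup ρ ρ′ v (λ p → agree (lookup v p) (call tt refl))))
  ren-cong-free≃ (suc k) (call X v) ρ ρ′ agree =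
    ≅-trans unfold (≅-trans (≡⇒≃ (ren-cong (λ p → Vec.lookup-map p ρ v) (body X)))
      (≅-trans (ren-cong-free≃ k (body X) (ρ ∘ lookup v) (ρ′ ∘ lookup v) agree-body)
        (≅-sym (≅-trans unfold (≡⇒≃ (ren-cong (λ p → Vec.lookup-map p ρ′ v) (body X)))))))
    where
      agree-body : ∀ p → Free (approx k) p (body X) → ρ (lookup v p) ≡ ρ′ (lookup v p)
      agree-body p p∈body = agree (lookup v p) (call (fromWitness p∈body) refl)

  ren-cong-fn≃ : ∀ {n m} (A : Species n) (ρ ρ′ : Fin n → Fin m) → (∀ i → i ∈fn A → ρ i ≡ ρ′ i) → ren′ ρ A ≃ ren′ ρ′ A
  ren-cong-fn≃ = ren-cong-free≃ (proj₁ fixedStage)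

  open Equivalence using (to; from)

  ∈fn-resp-≃ : ∀ {n} {A B : Species n} → A ≃ B → ∀ {i} → i ∈fn A ⇔ i ∈fn B
  ∈fn-resp-≃ ≅-refl = ⇔.refl
  ∈fn-resp-≃ (≅-sym A≃B) = ⇔.sym (∈fn-resp-≃ A≃B)
  ∈fn-resp-≃ (≅-trans A≃B B≃C) = ⇔.trans (∈fn-resp-≃ A≃B) (∈fn-resp-≃ B≃C)
  ∈fn-resp-≃ (pre-cong A≃B) = mk⇔
    (λ { site → site ; (under i∈A) → under (to (∈fn-resp-≃ A≃B) i∈A) })
    (λ { site → site ; (under i∈B) → under (from (∈fn-resp-≃ A≃B) i∈B) })
  ∈fn-resp-≃ (⊕-cong A≃A′ B≃B′) = mk⇔
    (λ { (⊕ˡ i∈A) → ⊕ˡ (to (∈fn-resp-≃ A≃A′) i∈A) ; (⊕ʳ i∈B) → ⊕ʳ (to (∈fn-resp-≃ B≃B′) i∈B) })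
    (λ { (⊕ˡ i∈A) → ⊕ˡ (from (∈fn-resp-≃ A≃A′) i∈A) ; (⊕ʳ i∈B) → ⊕ʳ (from (∈fn-resp-≃ B≃B′) i∈B) })
  ∈fn-resp-≃ (∥-cong A≃A′ B≃B′) = mk⇔
    (λ { (∥ˡ i∈A) → ∥ˡ (to (∈fn-resp-≃ A≃A′) i∈A) ; (∥ʳ i∈B) → ∥ʳ (to (∈fn-resp-≃ B≃B′) i∈B) })
    (λ { (∥ˡ i∈A) → ∥ˡ (from (∈fn-resp-≃ A≃A′) i∈A) ; (∥ʳ i∈B) → ∥ʳ (from (∈fn-resp-≃ B≃B′) i∈B) })
  ∈fn-resp-≃ (ν-cong A≃B) = mk⇔
    (λ { (ν i∈A) → ν (to (∈fn-resp-≃ A≃B) i∈A) })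
    (λ { (ν i∈B) → ν (from (∈fn-resp-≃ A≃B) i∈B) })
  ∈fn-resp-≃ ∥-assoc = mk⇔
    (λ { (∥ˡ (∥ˡ i∈A)) → ∥ˡ i∈A ; (∥ˡ (∥ʳ i∈B)) → ∥ʳ (∥ˡ i∈B) ; (∥ʳ i∈C) → ∥ʳ (∥ʳ i∈C) })
    (λ { (∥ˡ i∈A) → ∥ˡ (∥ˡ i∈A) ; (∥ʳ (∥ˡ i∈B)) → ∥ˡ (∥ʳ i∈B) ; (∥ʳ (∥ʳ i∈C)) → ∥ʳ i∈C })
  ∈fn-resp-≃ ∥-comm = mk⇔ (λ { (∥ˡ i∈A) → ∥ʳ i∈A ; (∥ʳ i∈B) → ∥ˡ i∈B }) (λ { (∥ˡ i∈B) → ∥ʳ i∈B ; (∥ʳ i∈A) → ∥ˡ i∈A })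
  ∈fn-resp-≃ ∥-unit = mk⇔ (λ { (∥ˡ i∈A) → i∈A }) ∥ˡ
  ∈fn-resp-≃ ⊕-assoc = mk⇔
    (λ { (⊕ˡ (⊕ˡ i∈A)) → ⊕ˡ i∈A ; (⊕ˡ (⊕ʳ i∈B)) → ⊕ʳ (⊕ˡ i∈B) ; (⊕ʳ i∈C) → ⊕ʳ (⊕ʳ i∈C) })
    (λ { (⊕ˡ i∈A) → ⊕ˡ (⊕ˡ i∈A) ; (⊕ʳ (⊕ˡ i∈B)) → ⊕ˡ (⊕ʳ i∈B) ; (⊕ʳ (⊕ʳ i∈C)) → ⊕ʳ i∈C })
  ∈fn-resp-≃ ⊕-comm = mk⇔ (λ { (⊕ˡ i∈A) → ⊕ʳ i∈A ; (⊕ʳ i∈B) → ⊕ˡ i∈B }) (λ { (⊕ˡ i∈B) → ⊕ʳ i∈B ; (⊕ʳ i∈A) → ⊕ˡ i∈A })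
  ∈fn-resp-≃ ν-zero = mk⇔ (λ { (ν ()) }) (λ ())
  ∈fn-resp-≃ (ν-swap {A = A}) = mk⇔ (λ { (ν (ν i∈A)) → ν (ν (free-ren⁺ swap i∈A)) }) backward
    where
      backward : ∀ {i} → i ∈fn ν (ν (ren′ swap A)) → i ∈fn ν (ν A)
      backward (ν (ν i∈A)) with free-ren⁻ swap A i∈A
      ... | suc (suc _) , refl , j∈A = ν (ν j∈A)
  ∈fn-resp-≃ (ν-extr {A = A} {B = B}) =
    mk⇔ forward (λ { (∥ˡ i∈A) → ν (∥ˡ (free-ren⁺ suc i∈A)) ; (∥ʳ (ν i∈B)) → ν (∥ʳ i∈B) })
    where
      forward : ∀ {i} → i ∈fn ν (ren′ suc A ∥ B) → i ∈fn A ∥ ν B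
      forward (ν (∥ˡ i∈A)) with free-ren⁻ suc A i∈A
      ... | _ , refl , j∈A = ∥ˡ j∈A
      forward (ν (∥ʳ i∈B)) = ∥ʳ (ν i∈B)
  ∈fn-resp-≃ (unfold {X = X} {v = v}) = mk⇔
    (λ { (call {p = p} p∈N refl) → free-ren⁺ (lookup v) (param-free⇒free-in-body X p p∈N) })
    backward
    where
      backward : ∀ {i} → i ∈fn ren′ (lookup v) (body X) → i ∈fn call X v
      backward i∈body with free-ren⁻ (lookup v) (body X) i∈body
      ... | p , v[p]≡i , p∈body = call (free-in-body⇒param-free X p p∈body) v[p]≡i

  ν-ren-suc : ∀ {n} (A : Species n) → ν (ren′ suc A) ≃ A
  ν-ren-suc A = ≅-trans (ν-cong (≅-sym ∥-unit)) (≅-trans ν-extr (≅-trans (∥-cong ≅-refl ν-zero) ∥-unit))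

  strengthen : ∀ {n} (A : Species (suc n)) → ¬ zero ∈fn A → A ≃ ren′ suc (ν A)
  strengthen A 0∉A = ≅-trans (≅-sym (ν-ren-suc A)) (ν-cong (ren-cong-fn≃ A suc (lift 1 suc) agree))
    where
      agree : ∀ i → i ∈fn A → suc i ≡ lift 1 suc i
      agree zero 0∈A = ⊥-elim (0∉A 0∈A)
      agree (suc i) _ = refl

  ∥-isCommutativeMonoid : ∀ {n} → IsCommutativeMonoid (_≃_ {n}) _∥_ 𝟎
  ∥-isCommutativeMonoid = record
    { isMonoid = record
      { isSemigroup = record
        { isMagma = record { isEquivalence = Setoid.isEquivalence (≅-setoid Site ar body _) ; ∙-cong = ∥-cong }
        ; assoc = λ _ _ _ → ∥-assoc }
      ; identity = (λ _ → ≅-trans ∥-comm ∥-unit) , (λ _ → ∥-unit) }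
    ; comm = λ _ _ → ∥-comm }

  module Perm {n} = PermutationSetoid (≅-setoid Site ar body n)
  module ↭ {n} = PermutationSetoidProperties (≅-setoid Site ar body n)
  open Perm using (_↭_; ↭-refl; ↭-sym; ↭-trans; ↭-reflexive)

  prep≃ : ∀ {n} {A B : Species n} {As Bs} → A ≃ B → As ↭ Bs → A ∷ As ↭ B ∷ Bs
  prep≃ {n} = Perm.prep {n}

  par-foldr : ∀ {n} (As : List (Species n)) → par′ As ≡ foldr _∥_ 𝟎 As
  par-foldr [] = refl
  par-foldr (A ∷ As) = cong (A ∥_) (par-foldr As)

  par-↭ : ∀ {n} {As Bs : List (Species n)} → As ↭ Bs → par′ As ≃ par′ Bs
  par-↭ {As = As} {Bs} As↭Bs rewrite par-foldr As | par-foldr Bs = ↭.foldr-commMonoid ∥-isCommutativeMonoid As↭Bs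

  par-++ : ∀ {n} (As Bs : List (Species n)) → par′ (As ++ Bs) ≃ par′ As ∥ par′ Bs
  par-++ [] Bs = ≅-sym (≅-trans ∥-comm ∥-unit)
  par-++ (A ∷ As) Bs = ≅-trans (∥-cong ≅-refl (par-++ As Bs)) (≅-sym ∥-assoc)

  Uses₀ : ∀ {n} → Species (suc n) → Set
  Uses₀ = zero ∈fn_

  uses₀? : ∀ {n} (A : Species (suc n)) → Dec (Uses₀ A)
  uses₀? = free? freeParams zero

  bundle : ∀ {m n} → (Species m → Species n) → List (Species m) → List (Species n)
  bundle f [] = []
  bundle f As@(_ ∷ _) = f (par′ As) ∷ []

  block : ∀ {n} → List (Species (suc n)) → List (Species n)
  block = bundle ν

  -- Components not using the bound name leave its scope, each under a now vacuous ν (terms cannot be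
  -- strengthened syntactically); those using it stay together under a single ν.
  νList : ∀ {n} → List (Species (suc n)) → List (Species n)
  νList As = map ν (filter (∁? uses₀?) As) ++ block (filter uses₀? As)

  data NF : ∀ {n} → Species n → List (Species n) → Set where
    nf-𝟎    : ∀ {n} → NF {n} 𝟎 []
    nf-pre  : ∀ {n s l k} {A : Species (k + n)} → NF (pre s l k A) (pre s l k A ∷ [])
    nf-⊕    : ∀ {n} {A B : Species n} → NF (A ⊕ B) ((A ⊕ B) ∷ [])
    nf-∥    : ∀ {n} {A B : Species n} {As Bs} → NF A As → NF B Bs → NF (A ∥ B) (As ++ Bs)
    nf-ν    : ∀ {n} {A : Species (suc n)} {As} → NF A As → NF (ν A) (νList As)
    nf-call : ∀ {n X} {v : Vec (Fin n) (ar X)} {As} → NF (ren′ (lookup v) (body X)) As → NF (call X v) As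

  NF-functional : ∀ {n} {A : Species n} {As Bs} → NF A As → NF A Bs → As ≡ Bs
  NF-functional nf-𝟎 nf-𝟎 = refl
  NF-functional nf-pre nf-pre = refl
  NF-functional nf-⊕ nf-⊕ = refl
  NF-functional (nf-∥ A↦ B↦) (nf-∥ A↦′ B↦′) = cong₂ _++_ (NF-functional A↦ A↦′) (NF-functional B↦ B↦′)
  NF-functional (nf-ν A↦) (nf-ν A↦′) = cong νList (NF-functional A↦ A↦′)
  NF-functional (nf-call A↦) (nf-call A↦′) = NF-functional A↦ A↦′

  partition-↭ : ∀ {n} {P : Species n → Set} (P? : ∀ A → Dec (P A)) (As : List (Species n))
              → As ↭ filter (∁? P?) As ++ filter P? As
  partition-↭ P? As =
    ↭-trans (subst (As ↭_) (cong (λ (Ps , Qs) → Ps ++ Qs) (partition-defn P? As)) (↭.partition-↭ P? As))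
            (↭.++-comm (filter P? As) (filter (∁? P?) As))

  strengthen-par : ∀ {n} (As : List (Species (suc n))) → All (∁ Uses₀) As → par′ As ≃ ren′ suc (par′ (map ν As))
  strengthen-par [] [] = ≅-refl
  strengthen-par (A ∷ As) (0∉A ∷ 0∉As) = ∥-cong (strengthen A 0∉A) (strengthen-par As 0∉As)

  par-block : ∀ {n} (As : List (Species n)) (Us : List (Species (suc n))) → par′ As ∥ ν (par′ Us) ≃ par′ (As ++ block Us)
  par-block As [] = ≅-trans (∥-cong ≅-refl ν-zero) (≅-trans ∥-unit (≡⇒≃ (cong par′ (sym (++-identityʳ As)))))
  par-block As (U ∷ Us) = ≅-trans (∥-cong ≅-refl (≅-sym ∥-unit)) (≅-sym (par-++ As _))

  νList-sound : ∀ {n} (As : List (Species (suc n))) → ν (par′ As) ≃ par′ (νList As)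
  νList-sound As =
    ≅-trans (ν-cong (par-↭ (partition-↭ uses₀? As)))
    (≅-trans (ν-cong (par-++ Rs Us))
    (≅-trans (ν-cong (∥-cong (strengthen-par Rs (all-filter (∁? uses₀?) As)) ≅-refl))
    (≅-trans ν-extr (par-block (map ν Rs) Us))))
    where
      Rs = filter (∁? uses₀?) As
      Us = filter uses₀? As

  NF-sound : ∀ {n} {A : Species n} {As} → NF A As → A ≃ par′ As
  NF-sound nf-𝟎 = ≅-refl
  NF-sound nf-pre = ≅-sym ∥-unit
  NF-sound nf-⊕ = ≅-sym ∥-unit
  NF-sound (nf-∥ {As = As} {Bs} A↦ B↦) = ≅-trans (∥-cong (NF-sound A↦) (NF-sound B↦)) (≅-sym (par-++ As Bs))
  NF-sound (nf-ν {As = As} A↦) = ≅-trans (ν-cong (NF-sound A↦)) (νList-sound As)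
  NF-sound (nf-call A↦) = ≅-trans unfold (NF-sound A↦)

  Uses₀-resp-≃ : ∀ {n} {A B : Species (suc n)} → A ≃ B → Uses₀ A → Uses₀ B
  Uses₀-resp-≃ A≃B = to (∈fn-resp-≃ A≃B)

  ∁Uses₀-resp-≃ : ∀ {n} {A B : Species (suc n)} → A ≃ B → ∁ Uses₀ A → ∁ Uses₀ B
  ∁Uses₀-resp-≃ A≃B 0∉A 0∈B = 0∉A (from (∈fn-resp-≃ A≃B) 0∈B)

  ∁Uses₀-ren-suc : ∀ {n} (A : Species n) → ∁ Uses₀ (ren′ suc A)
  ∁Uses₀-ren-suc A 0∈A with free-ren⁻ suc A 0∈A
  ... | _ , () , _

  filter-keeps : ∀ {n} {P : Species n → Set} (P? : ∀ A → Dec (P A)) {As Bs}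
               → All P As → All (∁ P) Bs → filter P? (As ++ Bs) ≡ As
  filter-keeps P? {As} {Bs} allP none = begin
    filter P? (As ++ Bs)          ≡⟨ filter-++ P? As Bs ⟩
    filter P? As ++ filter P? Bs  ≡⟨ cong₂ _++_ (filter-all P? allP) (filter-none P? none) ⟩
    As ++ []                      ≡⟨ ++-identityʳ As ⟩
    As                            ∎
    where open ≡-Reasoning

  filter-drops : ∀ {n} {P : Species n → Set} (P? : ∀ A → Dec (P A)) {As Bs}
               → All (∁ P) As → All P Bs → filter P? (As ++ Bs) ≡ Bs
  filter-drops P? {As} {Bs} none allP = trans (filter-++ P? As Bs) (cong₂ _++_ (filter-none P? none) (filter-all P? allP))

  ¬¬-intro-All : ∀ {n} {P : Species n → Set} {As} → All P As → All (∁ (∁ P)) As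
  ¬¬-intro-All = All.map λ p ¬p → ¬p p

  bundle-resp-↭ : ∀ {m n} {f : Species m → Species n} → (∀ {A B} → A ≃ B → f A ≃ f B)
                → ∀ {As Bs} → As ↭ Bs → bundle f As ↭ bundle f Bs
  bundle-resp-↭ f-cong {[]} {[]} _ = ↭-refl
  bundle-resp-↭ f-cong {[]} {_ ∷ _} As↭Bs with () ← ↭.xs↭ys⇒|xs|≡|ys| As↭Bs
  bundle-resp-↭ f-cong {_ ∷ _} {[]} As↭Bs with () ← ↭.xs↭ys⇒|xs|≡|ys| As↭Bs
  bundle-resp-↭ f-cong {_ ∷ _} {_ ∷ _} As↭Bs = prep≃ (f-cong (par-↭ As↭Bs)) ↭-refl

  map-resp-↭ : ∀ {m n} {f : Species m → Species n} → (∀ {A B} → A ≃ B → f A ≃ f B)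
             → ∀ {As Bs} → As ↭ Bs → map f As ↭ map f Bs
  map-resp-↭ = ↭.map⁺ (≅-setoid Site ar body _)

  νList-characterisation : ∀ {n} {As Rs Us : List (Species (suc n))}
                         → As ↭ Rs ++ Us → All (∁ Uses₀) Rs → All Uses₀ Us → νList As ↭ map ν Rs ++ block Us
  νList-characterisation {As = As} {Rs} {Us} As↭Rs++Us 0∉Rs 0∈Us =
    ↭.++⁺ (map-resp-↭ ν-cong kept) (bundle-resp-↭ ν-cong blocked)
    where
      kept : filter (∁? uses₀?) As ↭ Rs
      kept = ↭-trans (↭.filter⁺ (∁? uses₀?) ∁Uses₀-resp-≃ As↭Rs++Us)
                     (↭-reflexive (filter-keeps (∁? uses₀?) 0∉Rs (¬¬-intro-All 0∈Us)))
      blocked : filter uses₀? As ↭ Us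
      blocked = ↭-trans (↭.filter⁺ uses₀? Uses₀-resp-≃ As↭Rs++Us) (↭-reflexive (filter-drops uses₀? 0∉Rs 0∈Us))

  νList-resp-↭ : ∀ {n} {As Bs : List (Species (suc n))} → As ↭ Bs → νList As ↭ νList Bs
  νList-resp-↭ {As = As} As↭Bs = ↭-sym (νList-characterisation (↭-trans (↭-sym As↭Bs) (partition-↭ uses₀? As))
                                                               (all-filter (∁? uses₀?) As) (all-filter uses₀? As))

  ∁Uses₀-ren-lift : ∀ {n m} (ρ : Fin n → Fin m) {A} → ∁ Uses₀ A → ∁ Uses₀ (ren′ (lift 1 ρ) A)
  ∁Uses₀-ren-lift ρ {A} 0∉A 0∈ρA with free-ren⁻ (lift 1 ρ) A 0∈ρA
  ... | zero , _ , 0∈A = 0∉A 0∈A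

  block-ren : ∀ {n m} (ρ : Fin n → Fin m) (Us : List (Species (suc n)))
            → map (ren′ ρ) (block Us) ≡ block (map (ren′ (lift 1 ρ)) Us)
  block-ren ρ [] = refl
  block-ren ρ Us@(_ ∷ _) = cong (λ U → ν U ∷ []) (ren-par (lift 1 ρ) Us)

  NF-ren : ∀ {n m} {A : Species n} {As} → NF A As → (ρ : Fin n → Fin m)
         → ∀ {Bs} → NF (ren′ ρ A) Bs → Bs ↭ map (ren′ ρ) As
  NF-ren nf-𝟎 ρ nf-𝟎 = ↭-refl
  NF-ren nf-pre ρ nf-pre = ↭-refl
  NF-ren nf-⊕ ρ nf-⊕ = ↭-refl
  NF-ren (nf-∥ {As = As} {Bs} A↦ B↦) ρ (nf-∥ ρA↦ ρB↦) =
    ↭-trans (↭.++⁺ (NF-ren A↦ ρ ρA↦) (NF-ren B↦ ρ ρB↦)) (↭-reflexive (sym (map-++ (ren′ ρ) As Bs)))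
  NF-ren (nf-ν {As = As} A↦) ρ (nf-ν ρA↦) =
    ↭-trans (νList-characterisation renamed
               (All-map⁺ (All.map (∁Uses₀-ren-lift ρ) (all-filter (∁? uses₀?) As)))
               (All-map⁺ (All.map (free-ren⁺ (lift 1 ρ)) (all-filter uses₀? As))))
            (↭-reflexive (sym commute))
    where
      ρ₁ = ren′ (lift 1 ρ)
      Rs = filter (∁? uses₀?) As
      Us = filter uses₀? As
      renamed : _ ↭ map ρ₁ Rs ++ map ρ₁ Us
      renamed = ↭-trans (NF-ren A↦ (lift 1 ρ) ρA↦)
                  (↭-trans (map-resp-↭ (ren-≃ (lift 1 ρ)) (partition-↭ uses₀? As))
                    (↭-reflexive (map-++ ρ₁ Rs Us)))
      commute : map (ren′ ρ) (νList As) ≡ map ν (map ρ₁ Rs) ++ block (map ρ₁ Us)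
      commute = begin
        map (ren′ ρ) (map ν Rs ++ block Us)             ≡⟨ map-++ (ren′ ρ) (map ν Rs) (block Us) ⟩
        map (ren′ ρ) (map ν Rs) ++ map (ren′ ρ) (block Us) ≡⟨ cong₂ _++_ (trans (sym (map-∘ Rs)) (map-∘ Rs)) (block-ren ρ Us) ⟩
        map ν (map ρ₁ Rs) ++ block (map ρ₁ Us)          ∎
        where open ≡-Reasoning
  NF-ren (nf-call {X = X} {v = v} A↦) ρ (nf-call ρA↦) = NF-ren A↦ ρ (subst (λ A → NF A _) (ren-unfold ρ X v) ρA↦)

  ∈fn-ren-injective : ∀ {n m} (ρ : Fin n → Fin m) → (∀ {i j} → ρ i ≡ ρ j → i ≡ j)
                    → ∀ {i} (A : Species n) → ρ i ∈fn ren′ ρ A ⇔ i ∈fn A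
  ∈fn-ren-injective ρ ρ-injective A = mk⇔ backward (free-ren⁺ ρ)
    where
      backward : ∀ {i} → ρ i ∈fn ren′ ρ A → i ∈fn A
      backward ρi∈ρA with free-ren⁻ ρ A ρi∈ρA
      ... | j , ρj≡ρi , j∈A = subst (_∈fn A) (ρ-injective ρj≡ρi) j∈A

  swap-involutive : ∀ {n} (i : Fin (suc (suc n))) → swap (swap i) ≡ i
  swap-involutive zero = refl
  swap-involutive (suc zero) = refl
  swap-involutive (suc (suc i)) = refl

  swap-injective : ∀ {n} {i j : Fin (suc (suc n))} → swap i ≡ swap j → i ≡ j
  swap-injective {i = i} {j} eq = trans (sym (swap-involutive i)) (trans (cong swap eq) (swap-involutive j))

  ∉fn-par : ∀ {n} {i : Fin n} {As} → All (∁ (i ∈fn_)) As → ¬ i ∈fn par′ As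
  ∉fn-par (i∉A ∷ _) (∥ˡ i∈A) = i∉A i∈A
  ∉fn-par (_ ∷ i∉As) (∥ʳ i∈As) = ∉fn-par i∉As i∈As

  ∈fn-par : ∀ {n} {i : Fin n} {As} → Any (i ∈fn_) As → i ∈fn par′ As
  ∈fn-par (here i∈A) = ∥ˡ i∈A
  ∈fn-par (there i∈As) = ∥ʳ (∈fn-par i∈As)

  bundle-nonempty : ∀ {m n} (f : Species m → Species n) As B Bs → bundle f (As ++ B ∷ Bs) ≡ f (par′ (As ++ B ∷ Bs)) ∷ []
  bundle-nonempty f [] B Bs = refl
  bundle-nonempty f (_ ∷ _) B Bs = refl

  par-map-ν : ∀ {n} (Rs : List (Species (suc n))) → All (∁ Uses₀) Rs → par′ (map ν Rs) ≃ ν (par′ Rs)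
  par-map-ν Rs 0∉Rs = ≅-trans (≅-sym (ν-ren-suc _)) (ν-cong (≅-sym (strengthen-par Rs 0∉Rs)))

  par-map-ν-∷ʳ : ∀ {n} (Rs : List (Species (suc n))) (W : Species (suc n)) → All (∁ Uses₀) Rs
               → par′ (map ν Rs ++ ν W ∷ []) ≃ ν (par′ Rs ∥ W)
  par-map-ν-∷ʳ Rs W 0∉Rs =
    ≅-trans (par-++ (map ν Rs) _) (≅-trans (∥-cong ≅-refl ∥-unit)
      (≅-trans (≅-sym ν-extr) (ν-cong (∥-cong (≅-sym (strengthen-par Rs 0∉Rs)) ≅-refl))))

  Uses₁ : ∀ {n} → Species (suc (suc n)) → Set
  Uses₁ = suc zero ∈fn_

  uses₁? : ∀ {n} (A : Species (suc (suc n))) → Dec (Uses₁ A)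
  uses₁? = free? freeParams (suc zero)

  νν : ∀ {n} → Species (suc (suc n)) → Species n
  νν A = ν (ν A)

  νν-cong : ∀ {n} {A B : Species (suc (suc n))} → A ≃ B → νν A ≃ νν B
  νν-cong = ν-cong ∘ ν-cong

  record Quadrants {n} (Ms neither only₀ only₁ both : List (Species (suc (suc n)))) : Set where
    field
      partition : Ms ↭ (neither ++ only₁) ++ (only₀ ++ both)
      neither₀ : All (∁ Uses₀) neither
      neither₁ : All (∁ Uses₁) neither
      only₀₀ : All Uses₀ only₀
      only₀₁ : All (∁ Uses₁) only₀
      only₁₀ : All (∁ Uses₀) only₁
      only₁₁ : All Uses₁ only₁
      both₀ : All Uses₀ both
      both₁ : All Uses₁ both

  quadrants : ∀ {n} (Ms : List (Species (suc (suc n)))) → let Ns = filter (∁? uses₀?) Ms ; Us = filter uses₀? Ms in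
    Quadrants Ms (filter (∁? uses₁?) Ns) (filter (∁? uses₁?) Us) (filter uses₁? Ns) (filter uses₁? Us)
  quadrants Ms = record
    { partition = ↭-trans (partition-↭ uses₀? Ms) (↭.++⁺ (partition-↭ uses₁? Ns) (partition-↭ uses₁? Us))
    ; neither₀ = filter⁺ (∁? uses₁?) (all-filter (∁? uses₀?) Ms)
    ; neither₁ = all-filter (∁? uses₁?) Ns
    ; only₀₀ = filter⁺ (∁? uses₁?) (all-filter uses₀? Ms)
    ; only₀₁ = all-filter (∁? uses₁?) Us
    ; only₁₀ = filter⁺ uses₁? (all-filter (∁? uses₀?) Ms)
    ; only₁₁ = all-filter uses₁? Ns
    ; both₀ = filter⁺ uses₁? (all-filter uses₀? Ms)
    ; both₁ = all-filter uses₁? Us }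
    where
      Ns = filter (∁? uses₀?) Ms
      Us = filter uses₀? Ms

  ∁Uses₀-ν : ∀ {n} {A : Species (suc (suc n))} → ∁ Uses₁ A → ∁ Uses₀ (ν A)
  ∁Uses₀-ν 1∉A (ν 1∈A) = 1∉A 1∈A

  ∁Uses₀-block : ∀ {n} {Us : List (Species (suc (suc n)))} → All (∁ Uses₁) Us → All (∁ Uses₀) (block Us)
  ∁Uses₀-block {Us = []} _ = []
  ∁Uses₀-block {Us = _ ∷ _} 1∉Us = ∁Uses₀-ν (∉fn-par 1∉Us) ∷ []

  map-ν-block : ∀ {n} (Us : List (Species (suc (suc n)))) → map ν (block Us) ≡ bundle νν Us
  map-ν-block [] = refl
  map-ν-block (_ ∷ _) = refl

  block-map-ν : ∀ {n} (Rs : List (Species (suc (suc n)))) → All (∁ Uses₀) Rs → block (map ν Rs) ↭ bundle νν Rs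
  block-map-ν [] _ = ↭-refl
  block-map-ν Rs@(_ ∷ _) 0∉Rs = prep≃ (ν-cong (par-map-ν Rs 0∉Rs)) ↭-refl

  -- The normal form of νν A: the two bound names may be used by separate groups of components,
  -- which fuse into one group as soon as some component uses both.
  νν-outcome : ∀ {n} (neither only₀ only₁ both : List (Species (suc (suc n)))) → List (Species n)
  νν-outcome N O₀ O₁ [] = map νν N ++ bundle νν O₀ ++ bundle νν O₁
  νν-outcome N O₀ O₁ Bs@(_ ∷ _) = map νν N ++ bundle νν ((O₁ ++ O₀) ++ Bs)

  νList-separate : ∀ {n} (N O₀ O₁ : List (Species (suc (suc n))))
                 → All (∁ Uses₁) N → All (∁ Uses₁) O₀ → All (∁ Uses₀) O₁ → All Uses₁ O₁
                 → νList (map ν (N ++ O₁) ++ block O₀) ↭ map νν N ++ bundle νν O₀ ++ bundle νν O₁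
  νList-separate N O₀ O₁ 1∉N 1∉O₀ 0∉O₁ 1∈O₁ = begin
    νList (map ν (N ++ O₁) ++ block O₀)                ↭⟨ νList-characterisation separate 0∉ 0∈ ⟩
    map ν (map ν N ++ block O₀) ++ block (map ν O₁)    ≡⟨ cong (_++ block (map ν O₁)) (trans (map-++ ν (map ν N) (block O₀))
                                                              (cong₂ _++_ (sym (map-∘ N)) (map-ν-block O₀))) ⟩
    (map νν N ++ bundle νν O₀) ++ block (map ν O₁)     ≡⟨ ++-assoc (map νν N) (bundle νν O₀) (block (map ν O₁)) ⟩
    map νν N ++ bundle νν O₀ ++ block (map ν O₁)       ↭⟨ ↭.++⁺ˡ (map νν N) (↭.++⁺ˡ (bundle νν O₀) (block-map-ν O₁ 0∉O₁)) ⟩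
    map νν N ++ bundle νν O₀ ++ bundle νν O₁           ∎
    where
      open Perm.PermutationReasoning
      separate : map ν (N ++ O₁) ++ block O₀ ↭ (map ν N ++ block O₀) ++ map ν O₁
      separate = ↭-trans (↭-reflexive (trans (cong (_++ block O₀) (map-++ ν N O₁)) (++-assoc (map ν N) (map ν O₁) (block O₀))))
                 (↭-trans (↭.++⁺ˡ (map ν N) (↭.++-comm (map ν O₁) (block O₀)))
                          (↭-reflexive (sym (++-assoc (map ν N) (block O₀) (map ν O₁)))))
      0∉ : All (∁ Uses₀) (map ν N ++ block O₀)
      0∉ = All-++⁺ (All-map⁺ (All.map ∁Uses₀-ν 1∉N)) (∁Uses₀-block 1∉O₀)
      0∈ : All Uses₀ (map ν O₁)
      0∈ = All-map⁺ (All.map ν 1∈O₁)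

  νList-fused : ∀ {n} (N O₀ O₁ : List (Species (suc (suc n)))) B Bs
              → All (∁ Uses₁) N → All (∁ Uses₀) O₁ → All Uses₁ O₁ → Uses₁ B
              → νList (map ν (N ++ O₁) ++ block (O₀ ++ B ∷ Bs)) ↭ map νν N ++ bundle νν ((O₁ ++ O₀) ++ B ∷ Bs)
  νList-fused N O₀ O₁ B Bs 1∉N 0∉O₁ 1∈O₁ 1∈B rewrite bundle-nonempty ν O₀ B Bs = begin
    νList (map ν (N ++ O₁) ++ ν P ∷ [])               ↭⟨ νList-characterisation reassociate 0∉ 0∈ ⟩
    map ν (map ν N) ++ block (map ν O₁ ++ ν P ∷ [])   ≡⟨ cong₂ _++_ (sym (map-∘ N)) (bundle-nonempty ν (map ν O₁) (ν P) []) ⟩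
    map νν N ++ ν (par′ (map ν O₁ ++ ν P ∷ [])) ∷ []  ↭⟨ ↭.++⁺ˡ (map νν N) (prep≃ fuse ↭-refl) ⟩
    map νν N ++ νν (par′ All₀₁) ∷ []                  ≡⟨ cong (map νν N ++_) (sym (bundle-nonempty νν (O₁ ++ O₀) B Bs)) ⟩
    map νν N ++ bundle νν All₀₁                       ∎
    where
      open Perm.PermutationReasoning
      P = par′ (O₀ ++ B ∷ Bs)
      All₀₁ = (O₁ ++ O₀) ++ B ∷ Bs
      reassociate : map ν (N ++ O₁) ++ ν P ∷ [] ↭ map ν N ++ (map ν O₁ ++ ν P ∷ [])
      reassociate = ↭-reflexive (trans (cong (_++ ν P ∷ []) (map-++ ν N O₁)) (++-assoc (map ν N) (map ν O₁) (ν P ∷ [])))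
      0∉ : All (∁ Uses₀) (map ν N)
      0∉ = All-map⁺ (All.map ∁Uses₀-ν 1∉N)
      0∈ : All Uses₀ (map ν O₁ ++ ν P ∷ [])
      0∈ = All-++⁺ (All-map⁺ (All.map ν 1∈O₁)) (ν (∈fn-par (Any-++⁺ʳ O₀ (here 1∈B))) ∷ [])
      fuse : ν (par′ (map ν O₁ ++ ν P ∷ [])) ≃ νν (par′ All₀₁)
      fuse = ≅-trans (ν-cong (par-map-ν-∷ʳ O₁ P 0∉O₁))
               (νν-cong (≅-trans (≅-sym (par-++ O₁ (O₀ ++ B ∷ Bs))) (≡⇒≃ (cong par′ (sym (++-assoc O₁ O₀ (B ∷ Bs)))))))

  νν-shape : ∀ {n} {Ms N O₀ O₁ Bs : List (Species (suc (suc n)))} → Quadrants Ms N O₀ O₁ Bs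
           → νList (νList Ms) ↭ νν-outcome N O₀ O₁ Bs
  νν-shape {Ms = Ms} {N} {O₀} {O₁} {Bs} q = ↭-trans (νList-resp-↭ inner) (outer Bs both₁)
    where
      open Quadrants q
      inner : νList Ms ↭ map ν (N ++ O₁) ++ block (O₀ ++ Bs)
      inner = νList-characterisation partition (All-++⁺ neither₀ only₁₀) (All-++⁺ only₀₀ both₀)
      outer : ∀ Bs → All Uses₁ Bs → νList (map ν (N ++ O₁) ++ block (O₀ ++ Bs)) ↭ νν-outcome N O₀ O₁ Bs
      outer [] _ rewrite ++-identityʳ O₀ = νList-separate N O₀ O₁ neither₁ only₀₁ only₁₀ only₁₁
      outer (B ∷ Bs) (1∈B ∷ _) = νList-fused N O₀ O₁ B Bs neither₁ only₁₀ only₁₁ 1∈B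

  Uses₀-swap : ∀ {n} (A : Species (suc (suc n))) → Uses₀ (ren′ swap A) ⇔ Uses₁ A
  Uses₀-swap = ∈fn-ren-injective swap swap-injective

  Uses₁-swap : ∀ {n} (A : Species (suc (suc n))) → Uses₁ (ren′ swap A) ⇔ Uses₀ A
  Uses₁-swap = ∈fn-ren-injective swap swap-injective

  All-map-swap : ∀ {n} {P Q : Species (suc (suc n)) → Set} → (∀ A → P (ren′ swap A) ⇔ Q A)
               → ∀ {As} → All Q As → All P (map (ren′ swap) As)
  All-map-swap P⇔Q = All-map⁺ ∘ All.map (from (P⇔Q _))

  All-map-swap-∁ : ∀ {n} {P Q : Species (suc (suc n)) → Set} → (∀ A → P (ren′ swap A) ⇔ Q A)
                 → ∀ {As} → All (∁ Q) As → All (∁ P) (map (ren′ swap) As)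
  All-map-swap-∁ P⇔Q = All-map⁺ ∘ All.map (λ ¬Q → ¬Q ∘ to (P⇔Q _))

  quadrants-swap : ∀ {n} {Ms Ms′ N O₀ O₁ Bs : List (Species (suc (suc n)))} → Quadrants Ms N O₀ O₁ Bs
                 → Ms′ ↭ map (ren′ swap) Ms
                 → Quadrants Ms′ (map (ren′ swap) N) (map (ren′ swap) O₁) (map (ren′ swap) O₀) (map (ren′ swap) Bs)
  quadrants-swap {Ms = Ms} {Ms′} {N} {O₀} {O₁} {Bs} q Ms′↭ = record
    { partition = ↭-trans Ms′↭ (↭-trans (map-resp-↭ (ren-≃ swap) partition) exchange)
    ; neither₀ = All-map-swap-∁ Uses₀-swap neither₁
    ; neither₁ = All-map-swap-∁ Uses₁-swap neither₀
    ; only₀₀ = All-map-swap Uses₀-swap only₁₁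
    ; only₀₁ = All-map-swap-∁ Uses₁-swap only₁₀
    ; only₁₀ = All-map-swap-∁ Uses₀-swap only₀₁
    ; only₁₁ = All-map-swap Uses₁-swap only₀₀
    ; both₀ = All-map-swap Uses₀-swap both₁
    ; both₁ = All-map-swap Uses₁-swap both₀ }
    where
      open Quadrants q
      open Perm.PermutationReasoning
      s = map (ren′ swap)
      exchange : s ((N ++ O₁) ++ (O₀ ++ Bs)) ↭ (s N ++ s O₀) ++ (s O₁ ++ s Bs)
      exchange = begin
        s ((N ++ O₁) ++ (O₀ ++ Bs))        ≡⟨ trans (map-++ _ (N ++ O₁) (O₀ ++ Bs))
                                                    (cong₂ _++_ (map-++ _ N O₁) (map-++ _ O₀ Bs)) ⟩
        (s N ++ s O₁) ++ (s O₀ ++ s Bs)    ≡⟨ ++-assoc (s N) (s O₁) (s O₀ ++ s Bs) ⟩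
        s N ++ (s O₁ ++ s O₀ ++ s Bs)      ↭⟨ ↭.++⁺ˡ (s N) (↭.shifts (s O₁) (s O₀)) ⟩
        s N ++ (s O₀ ++ s O₁ ++ s Bs)      ≡⟨ sym (++-assoc (s N) (s O₀) (s O₁ ++ s Bs)) ⟩
        (s N ++ s O₀) ++ (s O₁ ++ s Bs)    ∎

  map-νν-swap : ∀ {n} (As : List (Species (suc (suc n)))) → map νν As ↭ map νν (map (ren′ swap) As)
  map-νν-swap [] = ↭-refl
  map-νν-swap (A ∷ As) = prep≃ ν-swap (map-νν-swap As)

  bundle-νν-swap : ∀ {n} (As : List (Species (suc (suc n)))) → bundle νν As ↭ bundle νν (map (ren′ swap) As)
  bundle-νν-swap [] = ↭-refl
  bundle-νν-swap As@(_ ∷ _) = prep≃ (≅-trans ν-swap (νν-cong (≡⇒≃ (ren-par swap As)))) ↭-refl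

  νν-outcome-swap : ∀ {n} (N O₀ O₁ Bs : List (Species (suc (suc n))))
                  → νν-outcome N O₀ O₁ Bs
                    ↭ νν-outcome (map (ren′ swap) N) (map (ren′ swap) O₁) (map (ren′ swap) O₀) (map (ren′ swap) Bs)
  νν-outcome-swap N O₀ O₁ [] =
    ↭.++⁺ (map-νν-swap N) (↭-trans (↭.++-comm (bundle νν O₀) (bundle νν O₁))
                                   (↭.++⁺ (bundle-νν-swap O₁) (bundle-νν-swap O₀)))
  νν-outcome-swap N O₀ O₁ Bs@(_ ∷ _) =
    ↭.++⁺ (map-νν-swap N) (↭-trans (bundle-νν-swap ((O₁ ++ O₀) ++ Bs)) (bundle-resp-↭ νν-cong exchange))
    where
      s = map (ren′ swap)
      exchange : s ((O₁ ++ O₀) ++ Bs) ↭ (s O₀ ++ s O₁) ++ s Bs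
      exchange = ↭-trans (↭-reflexive (trans (map-++ _ (O₁ ++ O₀) Bs) (cong (_++ s Bs) (map-++ _ O₁ O₀))))
                         (↭.++⁺ʳ (s Bs) (↭.++-comm (s O₁) (s O₀)))

  νν-swap-invariant : ∀ {n} {A : Species (suc (suc n))} {Ms Ms′} → NF A Ms → NF (ren′ swap A) Ms′
                    → νList (νList Ms) ↭ νList (νList Ms′)
  νν-swap-invariant {Ms = Ms} {Ms′} A↦ swapA↦ = via (quadrants Ms)
    where
      via : ∀ {N O₀ O₁ Bs} → Quadrants Ms N O₀ O₁ Bs → νList (νList Ms) ↭ νList (νList Ms′)
      via {N} {O₀} {O₁} {Bs} q =
        ↭-trans (νν-shape q)
          (↭-trans (νν-outcome-swap N O₀ O₁ Bs) (↭-sym (νν-shape (quadrants-swap q (NF-ren A↦ swap swapA↦)))))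

  map-ν-ren-suc : ∀ {n} (As : List (Species n)) → map ν (map (ren′ suc) As) ↭ As
  map-ν-ren-suc [] = ↭-refl
  map-ν-ren-suc (A ∷ As) = prep≃ (ν-ren-suc A) (map-ν-ren-suc As)

  _⊏_ : Fin d → Fin d → Set
  Y ⊏ X = UOcc Site ar Y (body X)

  uocc⇒occ : ∀ {Y n} {A : Species n} → UOcc Site ar Y A → Occ Site ar Y A
  uocc⇒occ (⊕ˡ u) = ⊕ˡ (uocc⇒occ u)
  uocc⇒occ (⊕ʳ u) = ⊕ʳ (uocc⇒occ u)
  uocc⇒occ (∥ˡ u) = ∥ˡ (uocc⇒occ u)
  uocc⇒occ (∥ʳ u) = ∥ʳ (uocc⇒occ u)
  uocc⇒occ (ν u) = ν (uocc⇒occ u)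
  uocc⇒occ here = here

  uocc-ren : ∀ {Y n m} (ρ : Fin n → Fin m) (A : Species n) → UOcc Site ar Y (ren′ ρ A) → UOcc Site ar Y A
  uocc-ren ρ (A ⊕ B) (⊕ˡ u) = ⊕ˡ (uocc-ren ρ A u)
  uocc-ren ρ (A ⊕ B) (⊕ʳ u) = ⊕ʳ (uocc-ren ρ B u)
  uocc-ren ρ (A ∥ B) (∥ˡ u) = ∥ˡ (uocc-ren ρ A u)
  uocc-ren ρ (A ∥ B) (∥ʳ u) = ∥ʳ (uocc-ren ρ B u)
  uocc-ren ρ (ν A) (ν u) = ν (uocc-ren (lift 1 ρ) A u)
  uocc-ren ρ (call X v) here = here

  ⊏⁺⇒mentions* : ∀ {Y X} → TransClosure _⊏_ Y X → Star (Mentions Site ar body) X Y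
  ⊏⁺⇒mentions* Plus.[ Y⊏X ] = uocc⇒occ Y⊏X ◅ ε
  ⊏⁺⇒mentions* (Y⊏Z Plus.∷ Z⊏⁺X) = ⊏⁺⇒mentions* Z⊏⁺X ◅◅ (uocc⇒occ Y⊏Z ◅ ε)

  module _ (guarded : Guarded Site ar body) where

    ⊏⁺-irreflexive : ∀ {X} → ¬ TransClosure _⊏_ X X
    ⊏⁺-irreflexive {X} Plus.[ X⊏X ] = guarded X X X⊏X ε
    ⊏⁺-irreflexive {X} (X⊏Z Plus.∷ Z⊏⁺X) = guarded _ X X⊏Z (⊏⁺⇒mentions* Z⊏⁺X)

    ⊏-wellFounded : WellFounded _⊏_
    ⊏-wellFounded = wellFounded⁻ _⊏_ (spo-wellFounded record
      { isEquivalence = isEquivalence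
      ; irrefl = λ { refl → ⊏⁺-irreflexive }
      ; trans = Plus._++_
      ; <-resp-≈ = resp₂ _ })

    nf-exists-below : ∀ {n} (A : Species n) X → Acc _⊏_ X → (∀ Y → UOcc Site ar Y A → Y ⊏ X)
                    → Σ (List (Species n)) (NF A)
    nf-exists-below 𝟎 X _ _ = [] , nf-𝟎
    nf-exists-below (pre s l k A) X _ _ = _ , nf-pre
    nf-exists-below (A ⊕ B) X _ _ = _ , nf-⊕
    nf-exists-below (A ∥ B) X accX below
      with nf-exists-below A X accX (λ Y → below Y ∘ ∥ˡ) | nf-exists-below B X accX (λ Y → below Y ∘ ∥ʳ)
    ... | As , A↦ | Bs , B↦ = _ , nf-∥ A↦ B↦
    nf-exists-below (ν A) X accX below with nf-exists-below A X accX (λ Y → below Y ∘ ν)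
    ... | As , A↦ = _ , nf-ν A↦
    nf-exists-below (call Y v) X (acc rs) below
      with nf-exists-below (ren′ (lookup v) (body Y)) Y (rs (below Y here)) (λ Z → uocc-ren (lookup v) (body Y))
    ... | As , A↦ = As , nf-call A↦

    nf-exists : ∀ {n} (A : Species n) → Σ (List (Species n)) (NF A)
    nf-exists 𝟎 = [] , nf-𝟎
    nf-exists (pre s l k A) = _ , nf-pre
    nf-exists (A ⊕ B) = _ , nf-⊕
    nf-exists (A ∥ B) with nf-exists A | nf-exists B
    ... | As , A↦ | Bs , B↦ = _ , nf-∥ A↦ B↦
    nf-exists (ν A) with nf-exists A
    ... | As , A↦ = _ , nf-ν A↦
    nf-exists (call X v)
      with nf-exists-below (ren′ (lookup v) (body X)) X (⊏-wellFounded X) (λ Y → uocc-ren (lookup v) (body X))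
    ... | As , A↦ = As , nf-call A↦

    NF-resp-≃ : ∀ {n} {A B : Species n} {As Bs} → A ≃ B → NF A As → NF B Bs → As ↭ Bs
    NF-resp-≃ ≅-refl A↦ A↦′ = ↭-reflexive (NF-functional A↦ A↦′)
    NF-resp-≃ (≅-sym B≃A) A↦ B↦ = ↭-sym (NF-resp-≃ B≃A B↦ A↦)
    NF-resp-≃ (≅-trans {B = B} A≃B B≃C) A↦ C↦ with nf-exists B
    ... | Bs , B↦ = ↭-trans (NF-resp-≃ A≃B A↦ B↦) (NF-resp-≃ B≃C B↦ C↦)
    NF-resp-≃ (pre-cong A≃B) nf-pre nf-pre = prep≃ (pre-cong A≃B) ↭-refl
    NF-resp-≃ (⊕-cong A≃A′ B≃B′) nf-⊕ nf-⊕ = prep≃ (⊕-cong A≃A′ B≃B′) ↭-refl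
    NF-resp-≃ (∥-cong A≃A′ B≃B′) (nf-∥ A↦ B↦) (nf-∥ A′↦ B′↦) = ↭.++⁺ (NF-resp-≃ A≃A′ A↦ A′↦) (NF-resp-≃ B≃B′ B↦ B′↦)
    NF-resp-≃ (ν-cong A≃B) (nf-ν A↦) (nf-ν B↦) = νList-resp-↭ (NF-resp-≃ A≃B A↦ B↦)
    NF-resp-≃ ∥-assoc (nf-∥ {Bs = Cs} (nf-∥ {As = As} {Bs} A↦ B↦) C↦) (nf-∥ A↦′ (nf-∥ B↦′ C↦′)) =
      ↭-reflexive (trans (++-assoc As Bs Cs)
        (cong₂ _++_ (NF-functional A↦ A↦′) (cong₂ _++_ (NF-functional B↦ B↦′) (NF-functional C↦ C↦′))))
    NF-resp-≃ ∥-comm (nf-∥ {As = As} {Bs} A↦ B↦) (nf-∥ B↦′ A↦′) =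
      ↭-trans (↭.++-comm As Bs) (↭-reflexive (cong₂ _++_ (NF-functional B↦ B↦′) (NF-functional A↦ A↦′)))
    NF-resp-≃ ∥-unit (nf-∥ {As = As} A↦ nf-𝟎) A↦′ = ↭-reflexive (trans (++-identityʳ As) (NF-functional A↦ A↦′))
    NF-resp-≃ ⊕-assoc nf-⊕ nf-⊕ = prep≃ ⊕-assoc ↭-refl
    NF-resp-≃ ⊕-comm nf-⊕ nf-⊕ = prep≃ ⊕-comm ↭-refl
    NF-resp-≃ ν-zero (nf-ν nf-𝟎) nf-𝟎 = ↭-refl
    NF-resp-≃ ν-swap (nf-ν (nf-ν A↦)) (nf-ν (nf-ν swapA↦)) = νν-swap-invariant A↦ swapA↦
    NF-resp-≃ (ν-extr {A = A}) (nf-ν (nf-∥ {As = As′} {Bs} sucA↦ B↦)) (nf-∥ {As = As} A↦ (nf-ν B↦′))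
      rewrite NF-functional B↦′ B↦ = begin
        νList (As′ ++ Bs)                               ↭⟨ νList-characterisation split 0∉ (all-filter uses₀? Bs) ⟩
        map ν (map (ren′ suc) As ++ Rs) ++ block Us     ≡⟨ trans (cong (_++ block Us) (map-++ ν (map (ren′ suc) As) Rs))
                                                                 (++-assoc (map ν (map (ren′ suc) As)) (map ν Rs) (block Us)) ⟩
        map ν (map (ren′ suc) As) ++ νList Bs           ↭⟨ ↭.++⁺ʳ (νList Bs) (map-ν-ren-suc As) ⟩
        As ++ νList Bs                                  ∎
      where
        open Perm.PermutationReasoning
        Rs = filter (∁? uses₀?) Bs
        Us = filter uses₀? Bs
        split : As′ ++ Bs ↭ (map (ren′ suc) As ++ Rs) ++ Us
        split = ↭-trans (↭.++⁺ (NF-ren A↦ suc sucA↦) (partition-↭ uses₀? Bs))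
                        (↭-reflexive (sym (++-assoc (map (ren′ suc) As) Rs Us)))
        0∉ : All (∁ Uses₀) (map (ren′ suc) As ++ Rs)
        0∉ = All-++⁺ (All-map⁺ (All.tabulate λ {B} _ → ∁Uses₀-ren-suc B)) (all-filter (∁? uses₀?) Bs)
    NF-resp-≃ unfold (nf-call A↦) A↦′ = ↭-reflexive (NF-functional A↦ A↦′)

    NF-length-≃ : ∀ {n} {A B : Species n} {As Bs} → A ≃ B → NF A As → NF B Bs → length As ≡ length Bs
    NF-length-≃ A≃B A↦ B↦ = ↭.xs↭ys⇒|xs|≡|ys| (NF-resp-≃ A≃B A↦ B↦)

    Stable : ∀ {n} → Species n → Set
    Stable A = ∀ As → NF A As → length As ≡ 1

    stable-NF : ∀ {n} {A : Species n} {As} → Stable A → NF A As → As ↭ A ∷ []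
    stable-NF {As = As} stable A↦ with As | stable As A↦ | NF-sound A↦
    ... | B ∷ [] | _ | A≃B∥𝟎 = prep≃ (≅-sym (≅-trans A≃B∥𝟎 ∥-unit)) ↭-refl

    stable-≄𝟎 : ∀ {n} {A : Species n} → Stable A → ¬ A ≃ 𝟎
    stable-≄𝟎 {A = A} stable A≃𝟎 with nf-exists A
    ... | As , A↦ with () ← trans (sym (stable As A↦)) (NF-length-≃ A≃𝟎 A↦ nf-𝟎)

    NF-par-stable : ∀ {n} {As Bs : List (Species n)} → All Stable As → NF (par′ As) Bs → Bs ↭ As
    NF-par-stable [] nf-𝟎 = ↭-refl
    NF-par-stable (stable ∷ stables) (nf-∥ A↦ As↦) = ↭.++⁺ (stable-NF stable A↦) (NF-par-stable stables As↦)

    length-νList-singleton : ∀ {n} {As Rs Us : List (Species (suc n))} → As ↭ Rs ++ Us → All (∁ Uses₀) Rs → All Uses₀ Us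
                           → length (map ν Rs ++ block Us) ≡ 1 → length (νList As) ≡ 1
    length-νList-singleton As↭ 0∉Rs 0∈Us length≡1 = trans (↭.xs↭ys⇒|xs|≡|ys| (νList-characterisation As↭ 0∉Rs 0∈Us)) length≡1

    ν-stable : ∀ {n} {A : Species (suc n)} → Stable A → ∁ Uses₀ A → Stable (ν A)
    ν-stable stable 0∉A _ (nf-ν A↦) = length-νList-singleton (stable-NF stable A↦) (0∉A ∷ []) [] refl

    ν-par-stable : ∀ {n} (Us : List (Species (suc n))) → All Stable Us → All Uses₀ Us → length Us ≢ 0 → Stable (ν (par′ Us))
    ν-par-stable [] _ _ ≢0 = ⊥-elim (≢0 refl)
    ν-par-stable Us@(_ ∷ _) stables 0∈Us _ _ (nf-ν Us↦) = length-νList-singleton (NF-par-stable stables Us↦) [] 0∈Us refl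

    NF-stable : ∀ {n} {A : Species n} {As} → NF A As → All Stable As
    NF-stable nf-𝟎 = []
    NF-stable nf-pre = (λ { _ nf-pre → refl }) ∷ []
    NF-stable nf-⊕ = (λ { _ nf-⊕ → refl }) ∷ []
    NF-stable (nf-∥ A↦ B↦) = All-++⁺ (NF-stable A↦) (NF-stable B↦)
    NF-stable (nf-ν {As = As} A↦) =
      All-++⁺ kept (blocked (filter uses₀? As) (filter⁺ uses₀? stables) (all-filter uses₀? As))
      where
        stables = NF-stable A↦
        kept : All Stable (map ν (filter (∁? uses₀?) As))
        kept = All-map⁺ (All.zipWith (λ (stable , 0∉A) → ν-stable stable 0∉A)
                                     (filter⁺ (∁? uses₀?) stables , all-filter (∁? uses₀?) As))
        blocked : ∀ Us → All Stable Us → All Uses₀ Us → All Stable (block Us)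
        blocked [] _ _ = []
        blocked Us@(_ ∷ _) stables′ 0∈Us = ν-par-stable Us stables′ 0∈Us (λ ()) ∷ []
    NF-stable (nf-call A↦) = NF-stable A↦

    stable⇒prime : ∀ {n} {P : Species n} → Stable P → Prime Site ar body P
    stable⇒prime {P = P} stable = stable-≄𝟎 stable , split
      where
        split : ∀ A B → P ≃ A ∥ B → A ≃ 𝟎 ⊎ B ≃ 𝟎
        split A B P≃A∥B with nf-exists P | nf-exists A | nf-exists B
        ... | Ps , P↦ | As , A↦ | Bs , B↦ =
          by-lengths As A↦ Bs B↦ (trans (sym (NF-length-≃ P≃A∥B P↦ (nf-∥ A↦ B↦))) (stable Ps P↦))
          where
            by-lengths : ∀ As → NF A As → ∀ Bs → NF B Bs → length (As ++ Bs) ≡ 1 → A ≃ 𝟎 ⊎ B ≃ 𝟎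
            by-lengths [] A↦ _ _ _ = inj₁ (NF-sound A↦)
            by-lengths (_ ∷ _) _ [] B↦ _ = inj₂ (NF-sound B↦)
            by-lengths (_ ∷ []) _ (_ ∷ _) _ ()
            by-lengths (_ ∷ _ ∷ _) _ (_ ∷ _) _ ()

    prime⇒stable : ∀ {n} {P : Species n} → Prime Site ar body P → Stable P
    prime⇒stable (P≄𝟎 , _) [] P↦ = ⊥-elim (P≄𝟎 (NF-sound P↦))
    prime⇒stable _ (_ ∷ []) _ = refl
    prime⇒stable (_ , split) (A ∷ As@(_ ∷ _)) P↦ with split A (par′ As) (NF-sound P↦) | NF-stable P↦
    ... | inj₁ A≃𝟎 | stable ∷ _ = ⊥-elim (stable-≄𝟎 stable A≃𝟎)
    ... | inj₂ As≃𝟎 | _ ∷ stables with nf-exists (par′ As)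
    ...   | Bs , As↦
      with () ← trans (sym (↭.xs↭ys⇒|xs|≡|ys| (NF-par-stable stables As↦))) (NF-length-≃ As≃𝟎 As↦ nf-𝟎)

    prime-decomposition : ∀ {n} (S : Species n) → Σ (List (Species n)) (PrimeDecomp Site ar body S)
    prime-decomposition S with nf-exists S
    ... | Ps , S↦ = Ps , All.map stable⇒prime (NF-stable S↦) , NF-sound S↦

    prime-decomposition-unique : ∀ {n} {Ps Qs : List (Species n)}
                               → All (Prime Site ar body) Ps → All (Prime Site ar body) Qs → par′ Ps ≃ par′ Qs → Ps ↭ Qs
    prime-decomposition-unique {Ps = Ps} {Qs} primePs primeQs Ps≃Qs with nf-exists (par′ Ps) | nf-exists (par′ Qs)
    ... | Ps′ , Ps↦ | Qs′ , Qs↦ =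
      ↭-trans (↭-sym (NF-par-stable (All.map prime⇒stable primePs) Ps↦))
        (↭-trans (NF-resp-≃ Ps≃Qs Ps↦ Qs↦) (NF-par-stable (All.map prime⇒stable primeQs) Qs↦))

mainTheorem1 : (Site : Set) {d : ℕ} (ar : Fin d → ℕ) (body : (X : Fin d) → Sp Site ar (ar X))
    → Guarded Site ar body
    → ∀ {n} (S : Sp Site ar n)
    → Σ (List (Sp Site ar n)) (λ Ps → PrimeDecomp Site ar body S Ps)
      × (∀ (Ps Qs : List (Sp Site ar n))
          → PrimeDecomp Site ar body S Ps → PrimeDecomp Site ar body S Qs
          → _≈ₘ_ Site ar body Ps Qs)
mainTheorem1 Site ar body guarded S =
  prime-decomposition Site ar body guarded S ,
  λ Ps Qs (primePs , S≃Ps) (primeQs , S≃Qs) →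
    prime-decomposition-unique Site ar body guarded primePs primeQs (≅-trans (≅-sym S≃Ps) S≃Qs)
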